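{- For every prime $p$, $g_{(3,1,3,2)}(p)=2p^4$.
   Context: For a prime $p$ and a tuple $\alpha=(\alpha_1,\dots,\alpha_{n-1})$ of positive integers, an irreducible subring matrix with diagonal $\alpha$ is an $n\times n$ upper triangular integer matrix $A$ with $A_{ii}=p^{\alpha_i}$ for $1\le i\le n-1$, $A_{nn}=1$, $A_{in}=1$ for all $i$, and $A_{ij}=p\,a_{ij}$ with integers $0\le a_{ij}\le p^{\alpha_i-1}-1$ for $1\le i<j\le n-1$, such that the $\mathbb{Z}$-span of the columns of $A$ is closed under componentwise multiplication of vectors. $g_\alpha(p)$ denotes the number of irreducible subring matrices with diagonal $\alpha$ (here $n=5$). -}

module Defs where

open import Data.Nat using (ℕ; zero; suc; _∸_; _^_; _≤_)
open import Data.Integer using (ℤ; +_; 0ℤ; 1ℤ) renaming (_+_ to _+ℤ_; _*_ to _*ℤ_)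
open import Data.Fin using (Fin; zero; suc; _<_; inject₁; fromℕ)
open import Data.Product using (_×_; Σ; ∃)
open import Data.List using (List; length)
open import Data.List.Membership.Propositional using (_∈_)
open import Data.List.Relation.Unary.Unique.Propositional using (Unique)
open import Function.Bundles using (_⇔_)
open import Relation.Binary.PropositionalEquality using (_≡_)

-- n = 5 throughout.  Diagonal data α = (α₁,…,α₄) : Fin 4 → ℕ.

-- The free parameters a_ij (1 ≤ i < j ≤ 4) of a 5×5 irreducible subring matrix:
-- a₁₂ a₁₃ a₁₄ a₂₃ a₂₄ a₃₄.
record Entries : Set where
  constructor entries
  field
    a12 a13 a14 a23 a24 a34 : ℕ

open Entries public

-- a_ij as a function of (i , j) ∈ Fin 4 × Fin 4 (index 0 ↔ row/column 1);
-- only used for i < j, set to 0 otherwise.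
aEntry : Entries → Fin 4 → Fin 4 → ℕ
aEntry e zero (suc zero) = a12 e
aEntry e zero (suc (suc zero)) = a13 e
aEntry e zero (suc (suc (suc zero))) = a14 e
aEntry e (suc zero) (suc (suc zero)) = a23 e
aEntry e (suc zero) (suc (suc (suc zero))) = a24 e
aEntry e (suc (suc zero)) (suc (suc (suc zero))) = a34 e
aEntry e _ _ = 0

matA : ℕ → (Fin 4 → ℕ) → Entries → Fin 5 → Fin 5 → ℤ
matA p α e i (suc (suc (suc (suc zero)))) = 1ℤ
matA p α e (suc (suc (suc (suc zero)))) _ = 0ℤ
matA p α e zero zero = + (p ^ α zero)
matA p α e (suc zero) (suc zero) = + (p ^ α (suc zero))
matA p α e (suc (suc zero)) (suc (suc zero)) = + (p ^ α (suc (suc zero)))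
matA p α e (suc (suc (suc zero))) (suc (suc (suc zero))) = + (p ^ α (suc (suc (suc zero))))
matA p α e zero (suc zero) = + (p Data.Nat.* a12 e)
matA p α e zero (suc (suc zero)) = + (p Data.Nat.* a13 e)
matA p α e zero (suc (suc (suc zero))) = + (p Data.Nat.* a14 e)
matA p α e (suc zero) (suc (suc zero)) = + (p Data.Nat.* a23 e)
matA p α e (suc zero) (suc (suc (suc zero))) = + (p Data.Nat.* a24 e)
matA p α e (suc (suc zero)) (suc (suc (suc zero))) = + (p Data.Nat.* a34 e)
matA p α e _ _ = 0ℤ

Vec5 : Set
Vec5 = Fin 5 → ℤ

sum5 : (Fin 5 → ℤ) → ℤ
sum5 f = f zero +ℤ (f (suc zero) +ℤ (f (suc (suc zero)) +ℤ
           (f (suc (suc (suc zero))) +ℤ f (suc (suc (suc (suc zero)))))))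

InColumnSpan : (Fin 5 → Fin 5 → ℤ) → Vec5 → Set
InColumnSpan M x = ∃ λ (c : Vec5) → ∀ i → sum5 (λ j → M i j *ℤ c j) ≡ x i

_⊙_ : Vec5 → Vec5 → Vec5
(x ⊙ y) i = x i *ℤ y i

SpanClosedUnderMult : (Fin 5 → Fin 5 → ℤ) → Set
SpanClosedUnderMult M =
  ∀ x y → InColumnSpan M x → InColumnSpan M y → InColumnSpan M (x ⊙ y)

EntriesInRange : ℕ → (Fin 4 → ℕ) → Entries → Set
EntriesInRange p α e = ∀ (i j : Fin 4) → i < j → aEntry e i j ≤ p ^ (α i ∸ 1) ∸ 1

IsIrreducibleSubringMatrix : ℕ → (Fin 4 → ℕ) → Entries → Set
IsIrreducibleSubringMatrix p α e =
  EntriesInRange p α e × SpanClosedUnderMult (matA p α e)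

-- g_α(p) = N : the irreducible subring matrices with diagonal α are exactly
-- the members of a duplicate-free list of length N.
g≡ : ℕ → (Fin 4 → ℕ) → ℕ → Set
g≡ p α N = Σ (List Entries) λ L →
  Unique L × length L ≡ N × (∀ e → (e ∈ L) ⇔ IsIrreducibleSubringMatrix p α e)

α3132 : Fin 4 → ℕ
α3132 zero = 3
α3132 (suc zero) = 1
α3132 (suc (suc zero)) = 3
α3132 (suc (suc (suc zero))) = 2

-- The range condition forces a₂₃ = a₂₄ = 0, after which the columns of A are
-- v₁ = (p³,0,0,0,0), v₂ = (p a₁₂,p,0,0,0), v₃ = (p a₁₃,0,p³,0,0), v₄ = (p a₁₄,0,p a₃₄,p²,0) and
-- the all-ones vector.  Since A is triangular with nonzero diagonal, a vector has at most one
-- coefficient vector; writing p³ (vⱼ ⊙ vⱼ) over the columns and comparing with the integral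
-- coefficients that closure provides shows p ∣ a₁₂² − a₁₂, p ∣ a₁₃², p ∣ a₃₄², and then p ∣ a₁₄².
-- So for prime p: a₁₂ ≡ 0 or 1 and a₁₃ ≡ a₁₄ ≡ a₃₄ ≡ 0 (mod p).  Conversely, under these
-- congruences the coefficients of (A f) ⊙ (A g) are explicit integer polynomials in f and g.
-- Each entry ranges over [0, p²), so there are 2p · p · p · p = 2p⁴ such matrices.

module Submission where

open import Defs
open import Data.Fin using (Fin; zero; suc; toℕ; fromℕ<)
open import Data.Fin.Properties using (toℕ-injective; toℕ<n; toℕ-fromℕ<)
open import Data.Integer using (ℤ; +_; 0ℤ; 1ℤ; _+_; _*_; _-_; ∣_∣; NonZero)
open import Data.Integer.Divisibility.Signed using (_∣_; divides; ∣ᵤ⇒∣; ∣⇒∣ᵤ; ∣m⇒∣m*n; ∣n⇒∣m*n)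
import Data.Integer.Properties as ℤ
open import Algebra.Properties.AbelianGroup ℤ.+-0-abelianGroup using (∙-cancelʳ)
open import Data.Integer.Tactic.RingSolver using (solve-∀)
open import Data.List using (List; []; _∷_; map; length; allFin; cartesianProductWith; cartesianProduct)
open import Data.List.Membership.Propositional using (_∈_)
open import Data.List.Membership.Propositional.Properties
  using (∈-allFin; ∈-cartesianProductWith⁺; ∈-cartesianProductWith⁻; ∈-cartesianProduct⁺; ∈-cartesianProduct⁻; ∈-map⁺; ∈-map⁻)
open import Data.List.Properties using (length-++; length-map; length-tabulate)
open import Data.List.Relation.Unary.Unique.Propositional using (Unique)
open import Data.List.Relation.Unary.Unique.Propositional.Properties as Unique
  using (allFin⁺; cartesianProduct⁺; cartesianProductWith⁺)
open import Data.Nat as ℕ using (ℕ; zero; suc; z≤n; s≤s)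
open import Data.Nat.DivMod using (_%_; [m+kn]%n≡m%n; m<n⇒m%n≡m)
import Data.Nat.Divisibility as ℕ
open import Data.Nat.Primality using (Prime; euclidsLemma; prime⇒nonTrivial)
import Data.Nat.Properties as ℕ
import Data.Nat.Tactic.RingSolver as ℕ-Solver
open import Data.Product using (_×_; _,_; ∃; ∃₂; proj₁; proj₂)
open import Data.Sum as Sum using (_⊎_; inj₁; inj₂; [_,_]′)
open import Function using (_∘_)
open import Function.Bundles using (mk⇔)
open import Relation.Binary.PropositionalEquality

pattern F0 = zero
pattern F1 = suc zero
pattern F2 = suc (suc zero)
pattern F3 = suc (suc (suc zero))
pattern F4 = suc (suc (suc (suc zero)))

sum5-cong : ∀ {f g : Vec5} → (∀ j → f j ≡ g j) → sum5 f ≡ sum5 g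
sum5-cong eq = cong₂ _+_ (eq F0) (cong₂ _+_ (eq F1) (cong₂ _+_ (eq F2) (cong₂ _+_ (eq F3) (eq F4))))

InColumnSpan-resp : ∀ {M N x} → (∀ i j → M i j ≡ N i j) → InColumnSpan N x → InColumnSpan M x
InColumnSpan-resp M≗N (c , eq) = c , λ i → trans (sum5-cong λ j → cong (_* c j) (M≗N i j)) (eq i)

SpanClosedUnderMult-resp : ∀ {M N} → (∀ i j → M i j ≡ N i j) → SpanClosedUnderMult N → SpanClosedUnderMult M
SpanClosedUnderMult-resp {M} {N} M≗N closed x y x∈ y∈ =
  InColumnSpan-resp M≗N (closed x y (InColumnSpan-resp N≗M x∈) (InColumnSpan-resp N≗M y∈))
  where
  N≗M : ∀ i j → N i j ≡ M i j
  N≗M i j = sym (M≗N i j)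

unit : Fin 5 → Vec5
unit F0 F0 = 1ℤ
unit F1 F1 = 1ℤ
unit F2 F2 = 1ℤ
unit F3 F3 = 1ℤ
unit F4 F4 = 1ℤ
unit _ _ = 0ℤ

sum5-unit : ∀ (g : Vec5) j → sum5 (λ k → g k * unit j k) ≡ g j
sum5-unit g F0 = unit₀ (g F0) (g F1) (g F2) (g F3) (g F4)
  where
  unit₀ : ∀ a b c d e → a * 1ℤ + (b * 0ℤ + (c * 0ℤ + (d * 0ℤ + e * 0ℤ))) ≡ a
  unit₀ = solve-∀
sum5-unit g F1 = unit₁ (g F0) (g F1) (g F2) (g F3) (g F4)
  where
  unit₁ : ∀ a b c d e → a * 0ℤ + (b * 1ℤ + (c * 0ℤ + (d * 0ℤ + e * 0ℤ))) ≡ b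
  unit₁ = solve-∀
sum5-unit g F2 = unit₂ (g F0) (g F1) (g F2) (g F3) (g F4)
  where
  unit₂ : ∀ a b c d e → a * 0ℤ + (b * 0ℤ + (c * 1ℤ + (d * 0ℤ + e * 0ℤ))) ≡ c
  unit₂ = solve-∀
sum5-unit g F3 = unit₃ (g F0) (g F1) (g F2) (g F3) (g F4)
  where
  unit₃ : ∀ a b c d e → a * 0ℤ + (b * 0ℤ + (c * 0ℤ + (d * 1ℤ + e * 0ℤ))) ≡ d
  unit₃ = solve-∀
sum5-unit g F4 = unit₄ (g F0) (g F1) (g F2) (g F3) (g F4)
  where
  unit₄ : ∀ a b c d e → a * 0ℤ + (b * 0ℤ + (c * 0ℤ + (d * 0ℤ + e * 1ℤ))) ≡ e
  unit₄ = solve-∀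

column∈span : ∀ M j → InColumnSpan M (λ i → M i j)
column∈span M j = unit j , λ i → sum5-unit (M i) j

Coeffs : Set
Coeffs = ℤ × ℤ × ℤ × ℤ × ℤ

toCoeffs : Vec5 → Coeffs
toCoeffs v = v F0 , v F1 , v F2 , v F3 , v F4

fromCoeffs : Coeffs → Vec5
fromCoeffs (h₀ , h₁ , h₂ , h₃ , h₄) = λ { F0 → h₀ ; F1 → h₁ ; F2 → h₂ ; F3 → h₃ ; F4 → h₄ }

_·ᶜ_ : Coeffs → ℤ → Coeffs
(h₀ , h₁ , h₂ , h₃ , h₄) ·ᶜ k = h₀ * k , h₁ * k , h₂ * k , h₃ * k , h₄ * k

-- The matrix of the theorem for α = (3,1,3,2) with a₂₃ = a₂₄ = 0, where P, A, B, C, D stand for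
-- p, a₁₂, a₁₃, a₁₄, a₃₄.
matrix : (P A B C D : ℤ) → Fin 5 → Fin 5 → ℤ
matrix P A B C D _  F4 = 1ℤ
matrix P A B C D F0 F0 = P * (P * P)
matrix P A B C D F0 F1 = P * A
matrix P A B C D F0 F2 = P * B
matrix P A B C D F0 F3 = P * C
matrix P A B C D F1 F1 = P
matrix P A B C D F2 F2 = P * (P * P)
matrix P A B C D F2 F3 = P * D
matrix P A B C D F3 F3 = P * P
matrix P A B C D _  _  = 0ℤ

-- matrix · h, with each coefficient written to the left of its entry so that zero coefficients
-- make their terms vanish definitionally.
combination : (P A B C D : ℤ) → Coeffs → Vec5
combination P A B C D (h₀ , h₁ , h₂ , h₃ , h₄) F0 =
  h₀ * (P * (P * P)) + (h₁ * (P * A) + (h₂ * (P * B) + (h₃ * (P * C) + h₄)))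
combination P A B C D (h₀ , h₁ , h₂ , h₃ , h₄) F1 = h₁ * P + h₄
combination P A B C D (h₀ , h₁ , h₂ , h₃ , h₄) F2 = h₂ * (P * (P * P)) + (h₃ * (P * D) + h₄)
combination P A B C D (h₀ , h₁ , h₂ , h₃ , h₄) F3 = h₃ * (P * P) + h₄
combination P A B C D (h₀ , h₁ , h₂ , h₃ , h₄) F4 = h₄

matrix-row : ∀ P A B C D i v →
  sum5 (λ j → matrix P A B C D i j * v j) ≡ combination P A B C D (toCoeffs v) i
matrix-row P A B C D F0 v = row₀ P A B C (v F0) (v F1) (v F2) (v F3) (v F4)
  where
  row₀ : ∀ P A B C v₀ v₁ v₂ v₃ v₄ →
    P * (P * P) * v₀ + (P * A * v₁ + (P * B * v₂ + (P * C * v₃ + 1ℤ * v₄)))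
      ≡ v₀ * (P * (P * P)) + (v₁ * (P * A) + (v₂ * (P * B) + (v₃ * (P * C) + v₄)))
  row₀ = solve-∀
matrix-row P A B C D F1 v = row₁ P (v F0) (v F1) (v F2) (v F3) (v F4)
  where
  row₁ : ∀ P v₀ v₁ v₂ v₃ v₄ → 0ℤ * v₀ + (P * v₁ + (0ℤ * v₂ + (0ℤ * v₃ + 1ℤ * v₄))) ≡ v₁ * P + v₄
  row₁ = solve-∀
matrix-row P A B C D F2 v = row₂ P D (v F0) (v F1) (v F2) (v F3) (v F4)
  where
  row₂ : ∀ P D v₀ v₁ v₂ v₃ v₄ →
    0ℤ * v₀ + (0ℤ * v₁ + (P * (P * P) * v₂ + (P * D * v₃ + 1ℤ * v₄)))
      ≡ v₂ * (P * (P * P)) + (v₃ * (P * D) + v₄)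
  row₂ = solve-∀
matrix-row P A B C D F3 v = row₃ P (v F0) (v F1) (v F2) (v F3) (v F4)
  where
  row₃ : ∀ P v₀ v₁ v₂ v₃ v₄ → 0ℤ * v₀ + (0ℤ * v₁ + (0ℤ * v₂ + (P * P * v₃ + 1ℤ * v₄))) ≡ v₃ * (P * P) + v₄
  row₃ = solve-∀
matrix-row P A B C D F4 v = row₄ (v F0) (v F1) (v F2) (v F3) (v F4)
  where
  row₄ : ∀ v₀ v₁ v₂ v₃ v₄ → 0ℤ * v₀ + (0ℤ * v₁ + (0ℤ * v₂ + (0ℤ * v₃ + 1ℤ * v₄))) ≡ v₄
  row₄ = solve-∀

combination∈span : ∀ {P A B C D x} h → (∀ i → combination P A B C D h i ≡ x i) →
  InColumnSpan (matrix P A B C D) x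
combination∈span {P} {A} {B} {C} {D} h eq =
  fromCoeffs h , λ i → trans (matrix-row P A B C D i (fromCoeffs h)) (eq i)

span⇒combination : ∀ {P A B C D x} → InColumnSpan (matrix P A B C D) x →
  ∃ λ h → ∀ i → combination P A B C D h i ≡ x i
span⇒combination {P} {A} {B} {C} {D} (c , eq) = toCoeffs c , λ i → trans (sym (matrix-row P A B C D i c)) (eq i)

private
  *-distribʳ-+₂ : ∀ x₀ x₁ m₀ k → x₀ * k * m₀ + x₁ * k ≡ (x₀ * m₀ + x₁) * k
  *-distribʳ-+₂ = solve-∀

  *-distribʳ-+₃ : ∀ x₀ x₁ x₂ m₀ m₁ k →
    x₀ * k * m₀ + (x₁ * k * m₁ + x₂ * k) ≡ (x₀ * m₀ + (x₁ * m₁ + x₂)) * k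
  *-distribʳ-+₃ = solve-∀

  *-distribʳ-+₅ : ∀ x₀ x₁ x₂ x₃ x₄ m₀ m₁ m₂ m₃ k →
    x₀ * k * m₀ + (x₁ * k * m₁ + (x₂ * k * m₂ + (x₃ * k * m₃ + x₄ * k)))
      ≡ (x₀ * m₀ + (x₁ * m₁ + (x₂ * m₂ + (x₃ * m₃ + x₄)))) * k
  *-distribʳ-+₅ = solve-∀

combination-*ʳ : ∀ P A B C D h k i →
  combination P A B C D (h ·ᶜ k) i ≡ combination P A B C D h i * k
combination-*ʳ P A B C D (h₀ , h₁ , h₂ , h₃ , h₄) k F0 = *-distribʳ-+₅ h₀ h₁ h₂ h₃ h₄ _ _ _ _ k
combination-*ʳ P A B C D (h₀ , h₁ , h₂ , h₃ , h₄) k F1 = *-distribʳ-+₂ h₁ h₄ P k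
combination-*ʳ P A B C D (h₀ , h₁ , h₂ , h₃ , h₄) k F2 = *-distribʳ-+₃ h₂ h₃ h₄ _ _ k
combination-*ʳ P A B C D (h₀ , h₁ , h₂ , h₃ , h₄) k F3 = *-distribʳ-+₂ h₃ h₄ (P * P) k
combination-*ʳ P A B C D (h₀ , h₁ , h₂ , h₃ , h₄) k F4 = refl

-- Coefficients of (matrix · f) ⊙ (matrix · g) when a₁₃ = S p, a₁₄ = U p, a₃₄ = W p and
-- a₁₂² − a₁₂ = T p, found by solving the triangular system from the last row up.
product : (P A T S U W : ℤ) → Coeffs → Coeffs → Coeffs
product P A T S U W (f₀ , f₁ , f₂ , f₃ , f₄) (g₀ , g₁ , g₂ , g₃ , g₄) =
    P * (P * P) * (f₀ * g₀) + P * A * (f₀ * g₁ + f₁ * g₀) + P * P * S * (f₀ * g₂ + f₂ * g₀)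
      + P * P * U * (f₀ * g₃ + f₃ * g₀) + (f₀ * g₄ + f₄ * g₀) + T * (f₁ * g₁)
      + A * S * (f₁ * g₂ + f₂ * g₁) + A * U * (f₁ * g₃ + f₃ * g₁) + (P * S * S - P * P * S) * (f₂ * g₂)
      + P * S * (U - W) * (f₂ * g₃ + f₃ * g₂) + (P * U * U - P * U - S * (W * W - W)) * (f₃ * g₃)
  , P * (f₁ * g₁) + (f₁ * g₄ + f₄ * g₁)
  , P * (P * P) * (f₂ * g₂) + P * P * W * (f₂ * g₃ + f₃ * g₂) + (f₂ * g₄ + f₄ * g₂)
      + P * (W * W - W) * (f₃ * g₃)
  , P * P * (f₃ * g₃) + (f₃ * g₄ + f₄ * g₃)
  , f₄ * g₄

product-combination : ∀ P A T S U W f g → A * A - A ≡ T * P → ∀ i →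
  let combine = combination P A (S * P) (U * P) (W * P) in
  combine (product P A T S U W f g) i ≡ combine f i * combine g i
product-combination P A T S U W (f₀ , f₁ , f₂ , f₃ , f₄) (g₀ , g₁ , g₂ , g₃ , g₄) a²-a≡TP F0 =
  trans (row₀ P A T S U W f₀ f₁ f₂ f₃ f₄ g₀ g₁ g₂ g₃ g₄) (vanish a²-a≡TP)
  where
  -- valid for every T; the error term vanishes exactly when a₁₂² − a₁₂ = T p
  row₀ : ∀ P A T S U W f₀ f₁ f₂ f₃ f₄ g₀ g₁ g₂ g₃ g₄ →
    (P * (P * P) * (f₀ * g₀) + P * A * (f₀ * g₁ + f₁ * g₀) + P * P * S * (f₀ * g₂ + f₂ * g₀)
      + P * P * U * (f₀ * g₃ + f₃ * g₀) + (f₀ * g₄ + f₄ * g₀) + T * (f₁ * g₁)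
      + A * S * (f₁ * g₂ + f₂ * g₁) + A * U * (f₁ * g₃ + f₃ * g₁) + (P * S * S - P * P * S) * (f₂ * g₂)
      + P * S * (U - W) * (f₂ * g₃ + f₃ * g₂) + (P * U * U - P * U - S * (W * W - W)) * (f₃ * g₃))
      * (P * (P * P))
    + ((P * (f₁ * g₁) + (f₁ * g₄ + f₄ * g₁)) * (P * A)
    + ((P * (P * P) * (f₂ * g₂) + P * P * W * (f₂ * g₃ + f₃ * g₂) + (f₂ * g₄ + f₄ * g₂)
        + P * (W * W - W) * (f₃ * g₃)) * (P * (S * P))
    + ((P * P * (f₃ * g₃) + (f₃ * g₄ + f₄ * g₃)) * (P * (U * P))
    + f₄ * g₄)))
    ≡ (f₀ * (P * (P * P)) + (f₁ * (P * A) + (f₂ * (P * (S * P)) + (f₃ * (P * (U * P)) + f₄))))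
      * (g₀ * (P * (P * P)) + (g₁ * (P * A) + (g₂ * (P * (S * P)) + (g₃ * (P * (U * P)) + g₄))))
      + (T * P - (A * A - A)) * (P * P * (f₁ * g₁))
  row₀ = solve-∀
  vanish : ∀ {X Y Z w} → X ≡ Y → w + (Y - X) * Z ≡ w
  vanish {Y = Y} {Z} {w} refl = trans (cong (λ t → w + t * Z) (ℤ.+-inverseʳ Y)) (ℤ.+-identityʳ w)
product-combination P A T S U W (f₀ , f₁ , f₂ , f₃ , f₄) (g₀ , g₁ , g₂ , g₃ , g₄) _ F1 =
  row₁ P f₁ f₄ g₁ g₄
  where
  row₁ : ∀ P f₁ f₄ g₁ g₄ →
    (P * (f₁ * g₁) + (f₁ * g₄ + f₄ * g₁)) * P + f₄ * g₄ ≡ (f₁ * P + f₄) * (g₁ * P + g₄)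
  row₁ = solve-∀
product-combination P A T S U W (f₀ , f₁ , f₂ , f₃ , f₄) (g₀ , g₁ , g₂ , g₃ , g₄) _ F2 =
  row₂ P W f₂ f₃ f₄ g₂ g₃ g₄
  where
  row₂ : ∀ P W f₂ f₃ f₄ g₂ g₃ g₄ →
    (P * (P * P) * (f₂ * g₂) + P * P * W * (f₂ * g₃ + f₃ * g₂) + (f₂ * g₄ + f₄ * g₂)
        + P * (W * W - W) * (f₃ * g₃)) * (P * (P * P))
      + ((P * P * (f₃ * g₃) + (f₃ * g₄ + f₄ * g₃)) * (P * (W * P)) + f₄ * g₄)
    ≡ (f₂ * (P * (P * P)) + (f₃ * (P * (W * P)) + f₄)) * (g₂ * (P * (P * P)) + (g₃ * (P * (W * P)) + g₄))
  row₂ = solve-∀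
product-combination P A T S U W (f₀ , f₁ , f₂ , f₃ , f₄) (g₀ , g₁ , g₂ , g₃ , g₄) _ F3 =
  row₃ P f₃ f₄ g₃ g₄
  where
  row₃ : ∀ P f₃ f₄ g₃ g₄ →
    (P * P * (f₃ * g₃) + (f₃ * g₄ + f₄ * g₃)) * (P * P) + f₄ * g₄ ≡ (f₃ * (P * P) + f₄) * (g₃ * (P * P) + g₄)
  row₃ = solve-∀
product-combination P A T S U W f g _ F4 = refl

matrix-spanClosedUnderMult : ∀ {P A B C D} → P ∣ A * A - A → P ∣ B → P ∣ C → P ∣ D →
  SpanClosedUnderMult (matrix P A B C D)
matrix-spanClosedUnderMult {P} {A} (divides T a²-a≡TP) (divides S refl) (divides U refl) (divides W refl) x y x∈ y∈
  with f , f≗x ← span⇒combination x∈ | g , g≗y ← span⇒combination y∈ =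
  combination∈span (product P A T S U W f g) λ i →
    trans (product-combination P A T S U W f g a²-a≡TP i) (cong₂ _*_ (f≗x i) (g≗y i))

module _ {P : ℤ} .{{_ : NonZero P}} where

  private
    cancel : ∀ m .{{_ : NonZero m}} x y t → x * m + t ≡ y * m + t → x ≡ y
    cancel m x y t eq = ℤ.*-cancelʳ-≡ x y m (∙-cancelʳ t _ _ eq)

    instance
      P²≢0 : NonZero (P * P)
      P²≢0 = ℤ.i*j≢0 P P
      P³≢0 : NonZero (P * (P * P))
      P³≢0 = ℤ.i*j≢0 P (P * P)

  combination-injective : ∀ {A B C D} h k →
    (∀ i → combination P A B C D h i ≡ combination P A B C D k i) → h ≡ k
  -- Back-substitution from the last row: once the later coefficients agree, both sides of a
  -- row share their tail and the pivot can be cancelled.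
  combination-injective (h₀ , h₁ , h₂ , h₃ , h₄) (k₀ , k₁ , k₂ , k₃ , k₄) eq
    with refl ← eq F4
    with refl ← cancel (P * P) h₃ k₃ k₄ (eq F3)
    with refl ← cancel P h₁ k₁ k₄ (eq F1)
    with refl ← cancel (P * (P * P)) h₂ k₂ _ (eq F2)
    with refl ← cancel (P * (P * P)) h₀ k₀ _ (eq F0)
    = refl

  module _ {A B C D : ℤ} (closed : SpanClosedUnderMult (matrix P A B C D)) where

    private
      column : ∀ j → InColumnSpan (matrix P A B C D) (λ i → matrix P A B C D i j)
      column = column∈span (matrix P A B C D)

    -- If p³ (column j)² = matrix · K, injectivity turns the coefficients h of (column j)²,
    -- which exist by closure, into K = p³ h.
    column²-coefficients : ∀ j K →
      (∀ i → matrix P A B C D i j * matrix P A B C D i j * (P * (P * P)) ≡ combination P A B C D K i) →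
      ∃ λ h → h ·ᶜ (P * (P * P)) ≡ K
    column²-coefficients j K column²≡K
      with h , h≗column² ← span⇒combination (closed _ _ (column j) (column j)) =
      h , combination-injective _ _ λ i → begin
        combination P A B C D (h ·ᶜ (P * (P * P))) i  ≡⟨ combination-*ʳ P A B C D h _ i ⟩
        combination P A B C D h i * (P * (P * P))     ≡⟨ cong (_* (P * (P * P))) (h≗column² i) ⟩
        matrix P A B C D i j * matrix P A B C D i j * (P * (P * P))  ≡⟨ column²≡K i ⟩
        combination P A B C D K i                      ∎
      where open ≡-Reasoning

    private
      ∣-from-P²-multiple : ∀ X Y Z h → P * P * X ≡ Y + Z * (P * (P * P)) → h * (P * (P * P)) ≡ Y → P ∣ X
      ∣-from-P²-multiple X _ Z h eq refl =
        divides (h + Z) (ℤ.*-cancelˡ-≡ (P * P) X ((h + Z) * P) (trans eq (regroup P h Z)))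
        where
        regroup : ∀ P h Z → h * (P * (P * P)) + Z * (P * (P * P)) ≡ P * P * ((h + Z) * P)
        regroup = solve-∀

    ∣A*A-A : P ∣ A * A - A
    ∣A*A-A =
      let (h₀ , _) , hP³≡K = column²-coefficients F1 _ column₁² in
      ∣-from-P²-multiple (A * A - A) _ 0ℤ h₀ (sym (ℤ.+-identityʳ _)) (cong proj₁ hP³≡K)
      where
      column₁² : ∀ i → matrix P A B C D i F1 * matrix P A B C D i F1 * (P * (P * P))
        ≡ combination P A B C D (P * P * (A * A - A) , P * (P * P) * P , 0ℤ , 0ℤ , 0ℤ) i
      column₁² F0 = row₀ P A
        where
        row₀ : ∀ P A → P * A * (P * A) * (P * (P * P))
          ≡ P * P * (A * A - A) * (P * (P * P)) + (P * (P * P) * P * (P * A) + 0ℤ)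
        row₀ = solve-∀
      column₁² F1 = row₁ P
        where
        row₁ : ∀ P → P * P * (P * (P * P)) ≡ P * (P * P) * P * P + 0ℤ
        row₁ = solve-∀
      column₁² F2 = refl
      column₁² F3 = refl
      column₁² F4 = refl

    ∣B*B : P ∣ B * B
    ∣B*B =
      let (h₀ , _) , hP³≡K = column²-coefficients F2 _ column₂² in
      ∣-from-P²-multiple (B * B) _ (P * B) h₀ (regroup P B) (cong proj₁ hP³≡K)
      where
      column₂² : ∀ i → matrix P A B C D i F2 * matrix P A B C D i F2 * (P * (P * P))
        ≡ combination P A B C D
            (P * P * (B * B) - P * P * P * P * B , 0ℤ , P * (P * P) * (P * (P * P)) , 0ℤ , 0ℤ) i
      column₂² F0 = row₀ P A B
        where
        row₀ : ∀ P A B → P * B * (P * B) * (P * (P * P))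
          ≡ (P * P * (B * B) - P * P * P * P * B) * (P * (P * P))
            + (0ℤ + (P * (P * P) * (P * (P * P)) * (P * B) + 0ℤ))
        row₀ = solve-∀
      column₂² F1 = refl
      column₂² F2 = row₂ P
        where
        row₂ : ∀ P → P * (P * P) * (P * (P * P)) * (P * (P * P))
          ≡ P * (P * P) * (P * (P * P)) * (P * (P * P)) + 0ℤ
        row₂ = solve-∀
      column₂² F3 = refl
      column₂² F4 = refl
      regroup : ∀ P B → P * P * (B * B) ≡ P * P * (B * B) - P * P * P * P * B + P * B * (P * (P * P))
      regroup = solve-∀

    private
      K₃ : Coeffs
      K₃ = P * P * (C * C) - P * P * P * C - B * (D * D) + P * B * D
         , 0ℤ
         , P * P * (D * D) - P * P * P * D
         , P * P * (P * (P * P))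
         , 0ℤ

      column₃² : ∀ i → matrix P A B C D i F3 * matrix P A B C D i F3 * (P * (P * P))
        ≡ combination P A B C D K₃ i
      column₃² F0 = row₀ P B C D
        where
        row₀ : ∀ P B C D → P * C * (P * C) * (P * (P * P))
          ≡ (P * P * (C * C) - P * P * P * C - B * (D * D) + P * B * D) * (P * (P * P))
            + (0ℤ + ((P * P * (D * D) - P * P * P * D) * (P * B) + (P * P * (P * (P * P)) * (P * C) + 0ℤ)))
        row₀ = solve-∀
      column₃² F1 = refl
      column₃² F2 = row₂ P D
        where
        row₂ : ∀ P D → P * D * (P * D) * (P * (P * P))
          ≡ (P * P * (D * D) - P * P * P * D) * (P * (P * P)) + (P * P * (P * (P * P)) * (P * D) + 0ℤ)
        row₂ = solve-∀
      column₃² F3 = row₃ P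
        where
        row₃ : ∀ P → P * P * (P * P) * (P * (P * P)) ≡ P * P * (P * (P * P)) * (P * P) + 0ℤ
        row₃ = solve-∀
      column₃² F4 = refl

    ∣D*D : P ∣ D * D
    ∣D*D =
      let (_ , _ , h₂ , _) , hP³≡K = column²-coefficients F3 K₃ column₃² in
      ∣-from-P²-multiple (D * D) _ D h₂ (regroup P D) (cong (λ h → proj₁ (proj₂ (proj₂ h))) hP³≡K)
      where
      regroup : ∀ P D → P * P * (D * D) ≡ P * P * (D * D) - P * P * P * D + D * (P * (P * P))
      regroup = solve-∀

    ∣C*C : P ∣ B → P ∣ D → P ∣ C * C
    ∣C*C (divides S B≡SP) (divides W D≡WP) =
      let (h₀ , _) , hP³≡K = column²-coefficients F3 K₃ column₃² in
      ∣-from-P²-multiple (C * C) _ (C + S * (W * W) - S * W) h₀ regroup (cong proj₁ hP³≡K)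
      where
      regroup : P * P * (C * C) ≡ proj₁ K₃ + (C + S * (W * W) - S * W) * (P * (P * P))
      regroup rewrite B≡SP | D≡WP = regroup′ P C S W
        where
        regroup′ : ∀ P C S W → P * P * (C * C)
          ≡ P * P * (C * C) - P * P * P * C - S * P * (W * P * (W * P)) + P * (S * P) * (W * P)
            + (C + S * (W * W) - S * W) * (P * (P * P))
        regroup′ = solve-∀

pos-square : ∀ p → + (p ℕ.^ 2) ≡ + p * + p
pos-square p = trans (cong (λ n → + (p ℕ.* n)) (ℕ.*-identityʳ p)) (ℤ.pos-* p p)

pos-cube : ∀ p → + (p ℕ.^ 3) ≡ + p * (+ p * + p)
pos-cube p = trans (ℤ.pos-* p (p ℕ.^ 2)) (cong (+ p *_) (pos-square p))

matA≡matrix : ∀ p a b c d i j →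
  matA p α3132 (entries a b c 0 0 d) i j ≡ matrix (+ p) (+ a) (+ b) (+ c) (+ d) i j
matA≡matrix p a b c d _  F4 = refl
matA≡matrix p a b c d F0 F0 = pos-cube p
matA≡matrix p a b c d F0 F1 = ℤ.pos-* p a
matA≡matrix p a b c d F0 F2 = ℤ.pos-* p b
matA≡matrix p a b c d F0 F3 = ℤ.pos-* p c
matA≡matrix p a b c d F1 F1 = cong +_ (ℕ.*-identityʳ p)
matA≡matrix p a b c d F1 F2 = cong +_ (ℕ.*-zeroʳ p)
matA≡matrix p a b c d F1 F3 = cong +_ (ℕ.*-zeroʳ p)
matA≡matrix p a b c d F2 F2 = pos-cube p
matA≡matrix p a b c d F2 F3 = ℤ.pos-* p d
matA≡matrix p a b c d F3 F3 = pos-square p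
matA≡matrix p a b c d F1 F0 = refl
matA≡matrix p a b c d F2 F0 = refl
matA≡matrix p a b c d F2 F1 = refl
matA≡matrix p a b c d F3 F0 = refl
matA≡matrix p a b c d F3 F1 = refl
matA≡matrix p a b c d F3 F2 = refl
matA≡matrix p a b c d F4 F0 = refl
matA≡matrix p a b c d F4 F1 = refl
matA≡matrix p a b c d F4 F2 = refl
matA≡matrix p a b c d F4 F3 = refl

A*A-A≡A*[A-1] : ∀ A → A * A - A ≡ A * (A - 1ℤ)
A*A-A≡A*[A-1] = solve-∀

∣⊎∣-1⇒∣A*A-A : ∀ {P A} → (P ∣ A) ⊎ (P ∣ A - 1ℤ) → P ∣ A * A - A
∣⊎∣-1⇒∣A*A-A {A = A} P∣A⊎P∣A-1 =
  subst (_ ∣_) (sym (A*A-A≡A*[A-1] A)) ([ ∣m⇒∣m*n (A - 1ℤ) , ∣n⇒∣m*n A ]′ P∣A⊎P∣A-1)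

module _ {p : ℕ} (p-prime : Prime p) where

  euclidsLemmaℤ : ∀ X Y → + p ∣ X * Y → (+ p ∣ X) ⊎ (+ p ∣ Y)
  euclidsLemmaℤ X Y p∣XY =
    Sum.map ∣ᵤ⇒∣ ∣ᵤ⇒∣ (euclidsLemma ∣ X ∣ ∣ Y ∣ p-prime (subst (p ℕ.∣_) (ℤ.abs-* X Y) (∣⇒∣ᵤ p∣XY)))

  ∣X*X⇒∣X : ∀ {X} → + p ∣ X * X → + p ∣ X
  ∣X*X⇒∣X {X} p∣X² = Sum.reduce (euclidsLemmaℤ X X p∣X²)

  ∣A*A-A⇒∣⊎∣-1 : ∀ {A} → + p ∣ A * A - A → (+ p ∣ A) ⊎ (+ p ∣ A - 1ℤ)
  ∣A*A-A⇒∣⊎∣-1 {A} p∣A²-A = euclidsLemmaℤ A (A - 1ℤ) (subst (_ ∣_) (A*A-A≡A*[A-1] A) p∣A²-A)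

-- a lies in [0, p²) and a mod p < k (for k ≤ p).
ResidueBelow : (p k a : ℕ) → Set
ResidueBelow p k a = ∃₂ λ q r → q ℕ.< p × r ℕ.< k × a ≡ r ℕ.+ q ℕ.* p

-- Indexing by Fin makes (q , r) ↦ r + q p injective on its whole domain, as
-- cartesianProductWith⁺ requires.
residues : ℕ → ℕ → List ℕ
residues p k = cartesianProductWith (λ (q : Fin p) (r : Fin k) → toℕ r ℕ.+ toℕ q ℕ.* p) (allFin p) (allFin k)

∈-residues⁺ : ∀ {p k a} → ResidueBelow p k a → a ∈ residues p k
∈-residues⁺ {p} {k} (q , r , q<p , r<k , refl) =
  subst (_∈ residues p k) (cong₂ (λ r q → r ℕ.+ q ℕ.* p) (toℕ-fromℕ< r<k) (toℕ-fromℕ< q<p))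
    (∈-cartesianProductWith⁺ _ (∈-allFin (fromℕ< q<p)) (∈-allFin (fromℕ< r<k)))

∈-residues⁻ : ∀ {p k a} → a ∈ residues p k → ResidueBelow p k a
∈-residues⁻ {p} {k} a∈ with q , r , _ , _ , refl ← ∈-cartesianProductWith⁻ _ (allFin p) (allFin k) a∈ =
  toℕ q , toℕ r , toℕ<n q , toℕ<n r , refl

residues-unique : ∀ {p k} .{{_ : ℕ.NonZero p}} → k ℕ.≤ p → Unique (residues p k)
residues-unique {p} {k} k≤p = cartesianProductWith⁺ _ injective (allFin⁺ p) (allFin⁺ k)
  where
  remainder : ∀ (r : Fin k) q → (toℕ r ℕ.+ q ℕ.* p) % p ≡ toℕ r
  remainder r q = trans ([m+kn]%n≡m%n (toℕ r) q p) (m<n⇒m%n≡m (ℕ.≤-trans (toℕ<n r) k≤p))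
  injective : ∀ {q q′ : Fin p} {r r′ : Fin k} →
    toℕ r ℕ.+ toℕ q ℕ.* p ≡ toℕ r′ ℕ.+ toℕ q′ ℕ.* p → q ≡ q′ × r ≡ r′
  injective {q} {q′} {r} {r′} eq = toℕ-injective q≡q′ , toℕ-injective r≡r′
    where
    r≡r′ : toℕ r ≡ toℕ r′
    r≡r′ = trans (sym (remainder r (toℕ q))) (trans (cong (_% p) eq) (remainder r′ (toℕ q′)))
    q≡q′ : toℕ q ≡ toℕ q′
    q≡q′ = ℕ.*-cancelʳ-≡ (toℕ q) (toℕ q′) p
      (ℕ.+-cancelˡ-≡ (toℕ r) _ _ (trans eq (cong (λ r → r ℕ.+ toℕ q′ ℕ.* p) (sym r≡r′))))

length-cartesianProductWith : ∀ {A B C : Set} (f : A → B → C) xs ys →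
  length (cartesianProductWith f xs ys) ≡ length xs ℕ.* length ys
length-cartesianProductWith f []       ys = refl
length-cartesianProductWith f (x ∷ xs) ys =
  trans (length-++ (map (f x) ys)) (cong₂ ℕ._+_ (length-map (f x) ys) (length-cartesianProductWith f xs ys))

length-residues : ∀ p k → length (residues p k) ≡ p ℕ.* k
length-residues p k =
  trans (length-cartesianProductWith _ (allFin p) (allFin k)) (cong₂ ℕ._*_ (length-tabulate {n = p} (λ i → i)) (length-tabulate {n = k} (λ i → i)))

ResidueBelow⇒<p² : ∀ {p k a} → k ℕ.≤ p → ResidueBelow p k a → a ℕ.< p ℕ.^ 2
ResidueBelow⇒<p² {p} k≤p (q , r , q<p , r<k , refl) = begin-strict
  r ℕ.+ q ℕ.* p     <⟨ ℕ.+-monoˡ-< (q ℕ.* p) (ℕ.<-≤-trans r<k k≤p) ⟩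
  p ℕ.+ q ℕ.* p     ≤⟨ ℕ.*-monoˡ-≤ p q<p ⟩
  p ℕ.* p           ≡⟨ cong (p ℕ.*_) (ℕ.*-identityʳ p) ⟨
  p ℕ.^ 2           ∎
  where open ℕ.≤-Reasoning

quotient<p : ∀ {p q r a} → a ≡ r ℕ.+ q ℕ.* p → a ℕ.< p ℕ.^ 2 → q ℕ.< p
quotient<p {p} {q} {r} refl a<p² = ℕ.*-cancelʳ-< p q p (begin-strict
  q ℕ.* p           ≤⟨ ℕ.m≤n+m (q ℕ.* p) r ⟩
  r ℕ.+ q ℕ.* p     <⟨ a<p² ⟩
  p ℕ.^ 2           ≡⟨ cong (p ℕ.*_) (ℕ.*-identityʳ p) ⟩
  p ℕ.* p           ∎)
  where open ℕ.≤-Reasoning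

∣⇒ResidueBelow : ∀ {p k a} → 0 ℕ.< k → a ℕ.< p ℕ.^ 2 → + p ∣ + a → ResidueBelow p k a
∣⇒ResidueBelow 0<k a<p² p∣a with ℕ.divides q refl ← ∣⇒∣ᵤ p∣a = q , 0 , quotient<p refl a<p² , 0<k , refl

∣-1⇒ResidueBelow₂ : ∀ {p a} .{{_ : ℕ.NonZero p}} → a ℕ.< p ℕ.^ 2 → + p ∣ + a - 1ℤ → ResidueBelow p 2 a
∣-1⇒ResidueBelow₂ {p} {zero}  _     _   = 0 , 0 , ℕ.>-nonZero⁻¹ p , s≤s z≤n , refl
∣-1⇒ResidueBelow₂ {p} {suc m} a<p² p∣m with ℕ.divides q refl ← ∣⇒∣ᵤ p∣m =
  q , 1 , quotient<p refl a<p² , s≤s (s≤s z≤n) , refl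

ResidueBelow₁⇒∣ : ∀ {p a} → ResidueBelow p 1 a → + p ∣ + a
ResidueBelow₁⇒∣ (q , _ , _ , s≤s z≤n , refl) = divides (+ q) (ℤ.pos-* q _)

ResidueBelow₂⇒∣⊎∣-1 : ∀ {p a} → ResidueBelow p 2 a → (+ p ∣ + a) ⊎ (+ p ∣ + a - 1ℤ)
ResidueBelow₂⇒∣⊎∣-1 (q , 0 , _ , _ , refl) = inj₁ (divides (+ q) (ℤ.pos-* q _))
ResidueBelow₂⇒∣⊎∣-1 (q , 1 , _ , _ , refl) = inj₂ (divides (+ q) (ℤ.pos-* q _))
ResidueBelow₂⇒∣⊎∣-1 (_ , suc (suc _) , _ , s≤s (s≤s ()) , _)

inRange⇒ : ∀ {p a₁₂ a₁₃ a₁₄ a₂₃ a₂₄ a₃₄} .{{_ : ℕ.NonZero p}} →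
  EntriesInRange p α3132 (entries a₁₂ a₁₃ a₁₄ a₂₃ a₂₄ a₃₄) →
  a₁₂ ℕ.< p ℕ.^ 2 × a₁₃ ℕ.< p ℕ.^ 2 × a₁₄ ℕ.< p ℕ.^ 2 × a₂₃ ≡ 0 × a₂₄ ≡ 0 × a₃₄ ℕ.< p ℕ.^ 2
inRange⇒ {p} inRange =
  below (inRange F0 F1 (s≤s z≤n)) , below (inRange F0 F2 (s≤s z≤n)) , below (inRange F0 F3 (s≤s z≤n)) ,
  ℕ.n≤0⇒n≡0 (inRange F1 F2 (s≤s (s≤s z≤n))) , ℕ.n≤0⇒n≡0 (inRange F1 F3 (s≤s (s≤s z≤n))) ,
  below (inRange F2 F3 (s≤s (s≤s (s≤s z≤n))))
  where
  below : ∀ {x} → x ℕ.≤ p ℕ.^ 2 ℕ.∸ 1 → x ℕ.< p ℕ.^ 2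
  below = ℕ.m≤pred[n]⇒suc[m]≤n {{ℕ.m^n≢0 p 2}}

inRange⇐ : ∀ {p a₁₂ a₁₃ a₁₄ a₃₄} →
  a₁₂ ℕ.< p ℕ.^ 2 → a₁₃ ℕ.< p ℕ.^ 2 → a₁₄ ℕ.< p ℕ.^ 2 → a₃₄ ℕ.< p ℕ.^ 2 →
  EntriesInRange p α3132 (entries a₁₂ a₁₃ a₁₄ 0 0 a₃₄)
inRange⇐ a₁₂< _ _ _ F0 F1 _ = ℕ.suc[m]≤n⇒m≤pred[n] a₁₂<
inRange⇐ _ a₁₃< _ _ F0 F2 _ = ℕ.suc[m]≤n⇒m≤pred[n] a₁₃<
inRange⇐ _ _ a₁₄< _ F0 F3 _ = ℕ.suc[m]≤n⇒m≤pred[n] a₁₄<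
inRange⇐ _ _ _ a₃₄< F2 F3 _ = ℕ.suc[m]≤n⇒m≤pred[n] a₃₄<
inRange⇐ _ _ _ _    F1 F2 _ = z≤n
inRange⇐ _ _ _ _    F1 F3 _ = z≤n
inRange⇐ _ _ _ _    F0 F0 ()
inRange⇐ _ _ _ _    F1 F0 ()
inRange⇐ _ _ _ _    F1 F1 (s≤s ())
inRange⇐ _ _ _ _    F2 F0 ()
inRange⇐ _ _ _ _    F2 F1 (s≤s ())
inRange⇐ _ _ _ _    F2 F2 (s≤s (s≤s ()))
inRange⇐ _ _ _ _    F3 F0 ()
inRange⇐ _ _ _ _    F3 F1 (s≤s ())
inRange⇐ _ _ _ _    F3 F2 (s≤s (s≤s ()))
inRange⇐ _ _ _ _    F3 F3 (s≤s (s≤s (s≤s ())))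

Admissible : ℕ → Entries → Set
Admissible p (entries a₁₂ a₁₃ a₁₄ a₂₃ a₂₄ a₃₄) =
  ResidueBelow p 2 a₁₂ × ResidueBelow p 1 a₁₃ × ResidueBelow p 1 a₁₄ × a₂₃ ≡ 0 × a₂₄ ≡ 0 × ResidueBelow p 1 a₃₄

module _ {p : ℕ} (p-prime : Prime p) where

  private
    instance
      p-nonTrivial : ℕ.NonTrivial p
      p-nonTrivial = prime⇒nonTrivial p-prime
      p-nonZero : ℕ.NonZero p
      p-nonZero = ℕ.nonTrivial⇒nonZero p

  admissible⇒irreducible : ∀ e → Admissible p e → IsIrreducibleSubringMatrix p α3132 e
  admissible⇒irreducible (entries a b c _ _ d) (ra , rb , rc , refl , refl , rd) =
    inRange⇐ (ResidueBelow⇒<p² (ℕ.nonTrivial⇒n>1 p) ra) (<p² rb) (<p² rc) (<p² rd) ,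
    SpanClosedUnderMult-resp (matA≡matrix p a b c d)
      (matrix-spanClosedUnderMult (∣⊎∣-1⇒∣A*A-A (ResidueBelow₂⇒∣⊎∣-1 ra))
        (ResidueBelow₁⇒∣ rb) (ResidueBelow₁⇒∣ rc) (ResidueBelow₁⇒∣ rd))
    where
    <p² : ∀ {x} → ResidueBelow p 1 x → x ℕ.< p ℕ.^ 2
    <p² = ResidueBelow⇒<p² (ℕ.>-nonZero⁻¹ p)

  irreducible⇒admissible : ∀ e → IsIrreducibleSubringMatrix p α3132 e → Admissible p e
  irreducible⇒admissible (entries a b c _ _ d) (inRange , closed)
    with a<p² , b<p² , c<p² , refl , refl , d<p² ← inRange⇒ inRange =
    [ ∣⇒ResidueBelow (s≤s z≤n) a<p² , ∣-1⇒ResidueBelow₂ a<p² ]′ (∣A*A-A⇒∣⊎∣-1 p-prime (∣A*A-A closedℤ)) ,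
    ∣⇒ResidueBelow (s≤s z≤n) b<p² p∣b ,
    ∣⇒ResidueBelow (s≤s z≤n) c<p² (∣X*X⇒∣X p-prime (∣C*C closedℤ p∣b p∣d)) ,
    refl , refl ,
    ∣⇒ResidueBelow (s≤s z≤n) d<p² p∣d
    where
    closedℤ : SpanClosedUnderMult (matrix (+ p) (+ a) (+ b) (+ c) (+ d))
    closedℤ = SpanClosedUnderMult-resp (λ i j → sym (matA≡matrix p a b c d i j)) closed
    p∣b : + p ∣ + b
    p∣b = ∣X*X⇒∣X p-prime (∣B*B closedℤ)
    p∣d : + p ∣ + d
    p∣d = ∣X*X⇒∣X p-prime (∣D*D closedℤ)

fromQuadruple : ℕ × ℕ × ℕ × ℕ → Entries
fromQuadruple (a₁₂ , a₁₃ , a₁₄ , a₃₄) = entries a₁₂ a₁₃ a₁₄ 0 0 a₃₄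

admissibleQuadruples : ℕ → List (ℕ × ℕ × ℕ × ℕ)
admissibleQuadruples p =
  cartesianProduct (residues p 2) (cartesianProduct (residues p 1) (cartesianProduct (residues p 1) (residues p 1)))

admissibleEntries : ℕ → List Entries
admissibleEntries p = map fromQuadruple (admissibleQuadruples p)

∈-admissibleEntries⁺ : ∀ {p} e → Admissible p e → e ∈ admissibleEntries p
∈-admissibleEntries⁺ (entries _ _ _ _ _ _) (ra , rb , rc , refl , refl , rd) =
  ∈-map⁺ fromQuadruple (∈-cartesianProduct⁺ (∈-residues⁺ ra)
    (∈-cartesianProduct⁺ (∈-residues⁺ rb) (∈-cartesianProduct⁺ (∈-residues⁺ rc) (∈-residues⁺ rd))))

∈-admissibleEntries⁻ : ∀ {p e} → e ∈ admissibleEntries p → Admissible p e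
∈-admissibleEntries⁻ {p} e∈
  with _ , abcd∈ , refl ← ∈-map⁻ fromQuadruple e∈
  with a∈ , bcd∈ ← ∈-cartesianProduct⁻ (residues p 2) _ abcd∈
  with b∈ , cd∈ ← ∈-cartesianProduct⁻ (residues p 1) _ bcd∈
  with c∈ , d∈ ← ∈-cartesianProduct⁻ (residues p 1) (residues p 1) cd∈ =
  ∈-residues⁻ a∈ , ∈-residues⁻ b∈ , ∈-residues⁻ c∈ , refl , refl , ∈-residues⁻ d∈

admissibleEntries-unique : ∀ {p} .{{_ : ℕ.NonTrivial p}} → Unique (admissibleEntries p)
admissibleEntries-unique {p} = Unique.map⁺ fromQuadruple-injective
  (cartesianProduct⁺ (residues-unique (ℕ.nonTrivial⇒n>1 p))
    (cartesianProduct⁺ (residues-unique 1≤p) (cartesianProduct⁺ (residues-unique 1≤p) (residues-unique 1≤p))))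
  where
  instance
    p-nonZero : ℕ.NonZero p
    p-nonZero = ℕ.nonTrivial⇒nonZero p
  1≤p : 1 ℕ.≤ p
  1≤p = ℕ.>-nonZero⁻¹ p
  fromQuadruple-injective : ∀ {x y} → fromQuadruple x ≡ fromQuadruple y → x ≡ y
  fromQuadruple-injective eq =
    cong₂ _,_ (cong a12 eq) (cong₂ _,_ (cong a13 eq) (cong₂ _,_ (cong a14 eq) (cong a34 eq)))

length-admissibleEntries : ∀ p → length (admissibleEntries p) ≡ 2 ℕ.* p ℕ.^ 4
length-admissibleEntries p = trans (length-map fromQuadruple (admissibleQuadruples p)) (trans lengths (count p))
  where
  length-× : ∀ {A B : Set} (xs : List A) (ys : List B) →
    length (cartesianProduct xs ys) ≡ length xs ℕ.* length ys
  length-× = length-cartesianProductWith _,_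
  lengths : length (admissibleQuadruples p) ≡ p ℕ.* 2 ℕ.* (p ℕ.* 1 ℕ.* (p ℕ.* 1 ℕ.* (p ℕ.* 1)))
  lengths =
    trans (length-× (residues p 2) _) (cong₂ ℕ._*_ (length-residues p 2)
      (trans (length-× (residues p 1) _) (cong₂ ℕ._*_ (length-residues p 1)
        (trans (length-× (residues p 1) (residues p 1)) (cong₂ ℕ._*_ (length-residues p 1) (length-residues p 1))))))
  count : ∀ p → p ℕ.* 2 ℕ.* (p ℕ.* 1 ℕ.* (p ℕ.* 1 ℕ.* (p ℕ.* 1))) ≡ 2 ℕ.* (p ℕ.* (p ℕ.* (p ℕ.* (p ℕ.* 1))))
  count = ℕ-Solver.solve-∀

lemma5p3 : (p : ℕ) → Prime p → g≡ p α3132 (2 ℕ.* p ℕ.^ 4)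
lemma5p3 p p-prime =
  admissibleEntries p , admissibleEntries-unique , length-admissibleEntries p ,
  λ e → mk⇔ (admissible⇒irreducible p-prime e ∘ ∈-admissibleEntries⁻)
            (∈-admissibleEntries⁺ e ∘ irreducible⇒admissible p-prime e)
  where
  instance
    p-nonTrivial : ℕ.NonTrivial p
    p-nonTrivial = prime⇒nonTrivial p-prime
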